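{- For all nonnegative integers $r,s,i$ and every nonnegative integer $j\le r+1$, the extended Wichmann ruler $w_1(r,s,i,j)$ is a complete sparse ruler.
   Context: A sparse ruler of length $n$ is a subset $R\subseteq\{0,\dots,n\}$ containing $0$ and $n$; it is complete if every $d\in\{0,\dots,n\}$ equals $|x-y|$ for some $x,y\in R$. A finite sequence $(b_1,\dots,b_k)$ of nonnegative integers (difference representation) determines the ruler $\{0,\,b_1,\,b_1+b_2,\,\dots,\,b_1+\cdots+b_k\}$, of length $b_1+\cdots+b_k$. Writing $a^t$ for $t$ consecutive copies of $a$, the extended Wichmann ruler $w_1(r,s,i,j)$ is the ruler with difference representation $$(1^r,\ r+1,\ (2r+1)^r,\ (4r+3)^s,\ (2r+2)^{r+1},\ 1^r,\ (r+1)^i,\ j).$$ -}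

module Defs where

open import Data.Nat using (ℕ; zero; suc; _+_; _*_; _≤_)
open import Data.List using (List; []; _∷_; _++_; replicate)
open import Data.Nat.ListAction using (sum)
open import Data.List.Membership.Propositional using (_∈_)
open import Data.Product using (_×_; ∃-syntax)
open import Relation.Binary.PropositionalEquality using (_≡_)

∣_-_∣ : ℕ → ℕ → ℕ
∣ zero  - y     ∣ = y
∣ suc x - zero  ∣ = suc x
∣ suc x - suc y ∣ = ∣ x - y ∣

marksFrom : ℕ → List ℕ → List ℕ
marksFrom a []       = a ∷ []
marksFrom a (b ∷ bs) = a ∷ marksFrom (a + b) bs

-- the ruler {0, b1, b1+b2, ..., b1+...+bk} (as a list of marks, possibly with repetitions)
ruler : List ℕ → List ℕ
ruler bs = marksFrom 0 bs

rulerLength : List ℕ → ℕ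
rulerLength bs = sum bs

IsSparseRuler : ℕ → List ℕ → Set
IsSparseRuler n R = (∀ {x} → x ∈ R → x ≤ n) × (0 ∈ R) × (n ∈ R)

IsCompleteSparseRuler : ℕ → List ℕ → Set
IsCompleteSparseRuler n R =
  IsSparseRuler n R ×
  (∀ d → d ≤ n → ∃[ x ] ∃[ y ] (x ∈ R × y ∈ R × ∣ x - y ∣ ≡ d))

w1diffs : ℕ → ℕ → ℕ → ℕ → List ℕ
w1diffs r s i j =
  replicate r 1 ++
  (r + 1) ∷
  replicate r (2 * r + 1) ++
  replicate s (4 * r + 3) ++
  replicate (r + 1) (2 * r + 2) ++
  replicate r 1 ++
  replicate i (r + 1) ++
  j ∷ []

w1 : ℕ → ℕ → ℕ → ℕ → List ℕ
w1 r s i j = ruler (w1diffs r s i j)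

w1length : ℕ → ℕ → ℕ → ℕ → ℕ
w1length r s i j = rulerLength (w1diffs r s i j)

-- Write a = 2r+1 and b = 2r+2 = a+1. The marks of w1(r,s,i,j) are the block A = [0, r],
-- P_m = m a (m ≤ r+1), Q_t = (t+r+1) a + t b (t ≤ s), B_u = (s+r+1) a + (s+u) b (u ≤ r+1),
-- the block C = [c, c+r] with c = (s+r+1)(a+b), the marks E_w = c+r+w(r+1) (w ≤ i) and the
-- last mark c+r+i(r+1)+j. The differences Q-P, B-Q and B-P realise every lattice point
-- α a + β b with |α-β| ≤ r+1 and α, β ≤ s+r+1, and as b = a+1 the lattice points on an
-- antidiagonal α+β = const are consecutive integers. A mark X minus A measures [X-r, X], and
-- C minus a mark Y measures [c-Y, c-Y+r]. Sweeping upwards, consecutive intervals of length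
-- b, a+b, a and r+1 are each covered by such runs; j ≤ r+1 makes the last mark close the
-- final gap.

module Submission where

open import Data.List using (List; []; _∷_; _++_; replicate)
open import Data.List.Membership.Propositional using (_∈_)
open import Data.List.Relation.Unary.Any using (here; there)
open import Data.Nat using (ℕ; zero; suc; _+_; _*_; _≤_; _<_; z≤n; s≤s; _<?_)
open import Data.Nat.ListAction using (sum)
open import Data.Nat.Properties
open import Data.Nat.Tactic.RingSolver using (solve)
open import Data.Product using (_×_; _,_; ∃-syntax)
open import Data.Sum using (inj₁; inj₂)
open import Function using (case_of_)
open import Relation.Binary.PropositionalEquality
open import Relation.Nullary using (yes; no; contradiction)

open import Defs

m+o≡n⇒m≤n : ∀ {m n} o → m + o ≡ n → m ≤ n
m+o≡n⇒m≤n {m} o refl = m≤m+n m o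

∣m+n-m∣≡n : ∀ m n → ∣ m + n - m ∣ ≡ n
∣m+n-m∣≡n zero    zero    = refl
∣m+n-m∣≡n zero    (suc n) = refl
∣m+n-m∣≡n (suc m) n       = ∣m+n-m∣≡n m n

sum-replicate-++ : ∀ n c ys → sum (replicate n c ++ ys) ≡ n * c + sum ys
sum-replicate-++ zero    c ys = refl
sum-replicate-++ (suc n) c ys =
  trans (cong (c +_) (sum-replicate-++ n c ys)) (sym (+-assoc c (n * c) (sum ys)))

∈-marksFrom-head : ∀ a bs → a ∈ marksFrom a bs
∈-marksFrom-head a []      = here refl
∈-marksFrom-head a (_ ∷ _) = here refl

∈-marksFrom-last : ∀ a bs → a + sum bs ∈ marksFrom a bs
∈-marksFrom-last a []       = here (+-identityʳ a)
∈-marksFrom-last a (b ∷ bs) =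
  there (subst (_∈ marksFrom (a + b) bs) (+-assoc a b (sum bs)) (∈-marksFrom-last (a + b) bs))

∈-marksFrom⇒≤ : ∀ a bs {x} → x ∈ marksFrom a bs → x ≤ a + sum bs
∈-marksFrom⇒≤ a []       (here refl) = ≤-reflexive (sym (+-identityʳ a))
∈-marksFrom⇒≤ a (b ∷ bs) (here refl) = m≤m+n a (b + sum bs)
∈-marksFrom⇒≤ a (b ∷ bs) (there x∈) =
  ≤-trans (∈-marksFrom⇒≤ (a + b) bs x∈) (≤-reflexive (+-assoc a b (sum bs)))

∈-marksFrom-replicate-++⁺ʳ : ∀ {a b y} n c {ys} → a + n * c ≡ b →
                             y ∈ marksFrom b ys → y ∈ marksFrom a (replicate n c ++ ys)
∈-marksFrom-replicate-++⁺ʳ {a} zero c refl y∈ = subst (λ x → _ ∈ marksFrom x _) (+-identityʳ a) y∈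
∈-marksFrom-replicate-++⁺ʳ {a} (suc n) c eq y∈ =
  there (∈-marksFrom-replicate-++⁺ʳ n c (trans (+-assoc a c (n * c)) eq) y∈)

∈-marksFrom-replicate-++ : ∀ {a y} n c ys t → t ≤ n → a + t * c ≡ y →
                           y ∈ marksFrom a (replicate n c ++ ys)
∈-marksFrom-replicate-++ {a} n c ys zero _ eq =
  subst (_∈ _) (trans (sym (+-identityʳ a)) eq) (∈-marksFrom-head a _)
∈-marksFrom-replicate-++ {a} (suc n) c ys (suc t) (s≤s t≤n) eq =
  there (∈-marksFrom-replicate-++ n c ys t t≤n (trans (+-assoc a c (t * c)) eq))

ruler-isSparseRuler : ∀ bs → IsSparseRuler (rulerLength bs) (ruler bs)
ruler-isSparseRuler bs = ∈-marksFrom⇒≤ 0 bs , ∈-marksFrom-head 0 bs , ∈-marksFrom-last 0 bs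

Measures : List ℕ → ℕ → Set
Measures R d = ∃[ x ] ∃[ y ] (x ∈ R × y ∈ R × ∣ x - y ∣ ≡ d)

record MeasuresRange (R : List ℕ) (lo hi : ℕ) : Set where
  constructor measuresRange
  field
    measures : ∀ d → lo ≤ d → d < hi → Measures R d

open MeasuresRange

measures-+ : ∀ {R x y d} → y ∈ R → x ∈ R → y + d ≡ x → Measures R d
measures-+ {y = y} {d} y∈ x∈ refl = y + d , y , x∈ , y∈ , ∣m+n-m∣≡n y d

range-++ : ∀ {R lo mid hi} → MeasuresRange R lo mid → MeasuresRange R mid hi → MeasuresRange R lo hi
range-++ {mid = mid} left right = measuresRange λ d lo≤d d<hi → case d <? mid of λ where
  (yes d<mid) → measures left d lo≤d d<mid
  (no  d≮mid) → measures right d (≮⇒≥ d≮mid) d<hi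

range-iterate : ∀ {R} (f : ℕ → ℕ) n → (∀ k → k < n → MeasuresRange R (f k) (f (suc k))) →
                MeasuresRange R (f 0) (f n)
range-iterate f zero    step = measuresRange λ d f0≤d d<f0 → contradiction f0≤d (<⇒≱ d<f0)
range-iterate f (suc n) step =
  range-++ (range-iterate f n (λ k k<n → step k (m<n⇒m<1+n k<n))) (step n ≤-refl)

range-belowMark : ∀ {R r X lo hi} → (∀ {e} → e ≤ r → e ∈ R) → X ∈ R →
                  X ≤ lo + r → hi ≤ suc X → MeasuresRange R lo hi
range-belowMark {r = r} {X} initial X∈ X≤lo+r hi≤1+X = measuresRange λ d lo≤d d<hi →
  measures-+ (initial (m≤n+o⇒m∸n≤o X d (≤-trans X≤lo+r (+-monoˡ-≤ r lo≤d))))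
             X∈ (m∸n+n≡m (m<1+n⇒m≤n (<-≤-trans d<hi hi≤1+X)))

range-aboveMark : ∀ {R r c Y lo hi} → (∀ {e} → e ≤ r → c + e ∈ R) → Y ∈ R →
                  c ≤ Y + lo → Y + hi ≤ c + suc r → MeasuresRange R lo hi
range-aboveMark {r = r} {c} {Y} final Y∈ c≤Y+lo Y+hi≤c+1+r = measuresRange λ d lo≤d d<hi →
  let c≤Y+d   = ≤-trans c≤Y+lo (+-monoʳ-≤ Y lo≤d)
      Y+d≤c+r = m<1+n⇒m≤n (subst (Y + d <_) (+-suc c r) (<-≤-trans (+-monoʳ-< Y d<hi) Y+hi≤c+1+r))
  in measures-+ Y∈ (final (m≤n+o⇒m∸n≤o (Y + d) c Y+d≤c+r)) (sym (m+[n∸m]≡n c≤Y+d))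

record Suffix (bs : List ℕ) (a : ℕ) (ys : List ℕ) : Set where
  field
    marks⊆ : ∀ {y} → y ∈ marksFrom a ys → y ∈ ruler bs
    ends   : a + sum ys ≡ rulerLength bs

open Suffix

suffix-refl : ∀ bs → Suffix bs 0 bs
suffix-refl bs = record { marks⊆ = λ y∈ → y∈ ; ends = refl }

suffix-∷ : ∀ {bs a b} x {ys} → Suffix bs a (x ∷ ys) → a + x ≡ b → Suffix bs b ys
suffix-∷ {a = a} x {ys} suffix refl = record
  { marks⊆ = λ y∈ → marks⊆ suffix (there y∈)
  ; ends   = trans (+-assoc a x (sum ys)) (ends suffix)
  }

suffix-replicate-++ : ∀ {bs a b} n c {ys} → Suffix bs a (replicate n c ++ ys) → a + n * c ≡ b →
                      Suffix bs b ys
suffix-replicate-++ {a = a} n c {ys} suffix refl = record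
  { marks⊆ = λ y∈ → marks⊆ suffix (∈-marksFrom-replicate-++⁺ʳ n c refl y∈)
  ; ends   = trans (+-assoc a (n * c) (sum ys))
                   (trans (cong (a +_) (sym (sum-replicate-++ n c ys))) (ends suffix))
  }

suffix-replicate-∈ : ∀ {bs a y} n c {ys} t → Suffix bs a (replicate n c ++ ys) → t ≤ n →
                     a + t * c ≡ y → y ∈ ruler bs
suffix-replicate-∈ n c t suffix t≤n eq = marks⊆ suffix (∈-marksFrom-replicate-++ n c _ t t≤n eq)

module Wichmann (r s i j : ℕ) where

  R : List ℕ
  R = w1 r s i j

  P-tail Q-tail B-tail C-tail E-tail : List ℕ
  E-tail = replicate i (r + 1) ++ j ∷ []
  C-tail = replicate r 1 ++ E-tail
  B-tail = replicate (r + 1) (2 * r + 2) ++ C-tail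
  Q-tail = replicate s (4 * r + 3) ++ B-tail
  P-tail = replicate r (2 * r + 1) ++ Q-tail

  P-suffix : Suffix (w1diffs r s i j) (2 * r + 1) P-tail
  P-suffix = suffix-∷ (r + 1) (suffix-replicate-++ r 1 (suffix-refl _) refl) (solve (r ∷ []))

  Q-suffix : Suffix (w1diffs r s i j) ((r + 1) * (2 * r + 1)) Q-tail
  Q-suffix = suffix-replicate-++ r (2 * r + 1) P-suffix (solve (r ∷ []))

  B-suffix : Suffix (w1diffs r s i j) ((s + suc r) * (2 * r + 1) + s * (2 * r + 2)) B-tail
  B-suffix = suffix-replicate-++ s (4 * r + 3) Q-suffix (solve (r ∷ s ∷ []))

  C-suffix : Suffix (w1diffs r s i j) ((s + suc r) * (4 * r + 3)) C-tail
  C-suffix = suffix-replicate-++ (r + 1) (2 * r + 2) B-suffix (solve (r ∷ s ∷ []))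

  E-suffix : Suffix (w1diffs r s i j) ((s + suc r) * (4 * r + 3) + r) E-tail
  E-suffix = suffix-replicate-++ r 1 C-suffix (cong ((s + suc r) * (4 * r + 3) +_) (*-identityʳ r))

  w1-length : w1length r s i j ≡ (s + suc r) * (4 * r + 3) + r + i * (r + 1) + j
  w1-length =
    trans (sym (ends (suffix-replicate-++ i (r + 1) E-suffix refl))) (cong (_ +_) (+-identityʳ j))

  ∈-A : ∀ {e} → e ≤ r → e ∈ R
  ∈-A {e} e≤r = suffix-replicate-∈ r 1 e (suffix-refl _) e≤r (*-identityʳ e)

  ∈-P : ∀ m → m ≤ suc r → m * (2 * r + 1) ∈ R
  ∈-P zero    _         = ∈-A z≤n
  ∈-P (suc m) (s≤s m≤r) = suffix-replicate-∈ r (2 * r + 1) m P-suffix m≤r refl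

  ∈-Q : ∀ t → t ≤ s → (t + suc r) * (2 * r + 1) + t * (2 * r + 2) ∈ R
  ∈-Q t t≤s = suffix-replicate-∈ s (4 * r + 3) t Q-suffix t≤s position
    where
    position : (r + 1) * (2 * r + 1) + t * (4 * r + 3) ≡ (t + suc r) * (2 * r + 1) + t * (2 * r + 2)
    position = solve (t ∷ r ∷ [])

  ∈-B : ∀ u → u ≤ suc r → (s + suc r) * (2 * r + 1) + (s + u) * (2 * r + 2) ∈ R
  ∈-B u u≤1+r = suffix-replicate-∈ (r + 1) (2 * r + 2) u B-suffix
                  (≤-trans u≤1+r (≤-reflexive (+-comm 1 r))) position
    where
    position : (s + suc r) * (2 * r + 1) + s * (2 * r + 2) + u * (2 * r + 2)
             ≡ (s + suc r) * (2 * r + 1) + (s + u) * (2 * r + 2)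
    position = solve (u ∷ r ∷ s ∷ [])

  ∈-C : ∀ {v} → v ≤ r → (s + suc r) * (4 * r + 3) + v ∈ R
  ∈-C {v} v≤r =
    suffix-replicate-∈ r 1 v C-suffix v≤r (cong ((s + suc r) * (4 * r + 3) +_) (*-identityʳ v))

  ∈-E : ∀ w → w ≤ i → (s + suc r) * (4 * r + 3) + r + w * (r + 1) ∈ R
  ∈-E w w≤i = suffix-replicate-∈ i (r + 1) w E-suffix w≤i refl

  measures-Q-P : ∀ α β → β ≤ α → β ≤ s → α ≤ β + suc r →
                 Measures R (α * (2 * r + 1) + β * (2 * r + 2))
  measures-Q-P α β β≤α β≤s α≤β+1+r with m≤n⇒∃[o]m+o≡n α≤β+1+r
  ... | m , α+m≡β+1+r = measures-+ (∈-P m m≤1+r) (∈-Q β β≤s) (begin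
    m * (2 * r + 1) + (α * (2 * r + 1) + β * (2 * r + 2))
      ≡⟨ solve (m ∷ α ∷ β ∷ r ∷ []) ⟩
    (α + m) * (2 * r + 1) + β * (2 * r + 2)
      ≡⟨ cong (λ x → x * (2 * r + 1) + β * (2 * r + 2)) α+m≡β+1+r ⟩
    (β + suc r) * (2 * r + 1) + β * (2 * r + 2) ∎)
    where
    open ≡-Reasoning
    m≤1+r : m ≤ suc r
    m≤1+r = +-cancelˡ-≤ β m (suc r) (≤-trans (+-monoˡ-≤ m β≤α) (≤-reflexive α+m≡β+1+r))

  measures-B-Q : ∀ α β → α ≤ β → α ≤ s → β ≤ α + suc r →
                 Measures R (α * (2 * r + 1) + β * (2 * r + 2))
  measures-B-Q α β α≤β α≤s β≤α+1+r with m≤n⇒∃[o]m+o≡n α≤β | m≤n⇒∃[o]m+o≡n α≤s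
  ... | u , refl | p , refl =
    measures-+ (∈-Q p (m≤n+m p α)) (∈-B u (+-cancelˡ-≤ α u (suc r) β≤α+1+r)) Q+d≡B
    where
    Q+d≡B : (p + suc r) * (2 * r + 1) + p * (2 * r + 2) + (α * (2 * r + 1) + (α + u) * (2 * r + 2))
          ≡ (α + p + suc r) * (2 * r + 1) + (α + p + u) * (2 * r + 2)
    Q+d≡B = solve (α ∷ u ∷ p ∷ r ∷ [])

  measures-B-P : ∀ α β → s ≤ α → s ≤ β → α ≤ s + suc r → β ≤ s + suc r →
                 Measures R (α * (2 * r + 1) + β * (2 * r + 2))
  measures-B-P α β s≤α s≤β α≤s+1+r β≤s+1+r with m≤n⇒∃[o]m+o≡n α≤s+1+r | m≤n⇒∃[o]m+o≡n s≤β
  ... | m , α+m≡s+1+r | u , refl =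
    measures-+ (∈-P m m≤1+r) (∈-B u (+-cancelˡ-≤ s u (suc r) β≤s+1+r)) (begin
      m * (2 * r + 1) + (α * (2 * r + 1) + (s + u) * (2 * r + 2))
        ≡⟨ solve (m ∷ α ∷ s ∷ u ∷ r ∷ []) ⟩
      (α + m) * (2 * r + 1) + (s + u) * (2 * r + 2)
        ≡⟨ cong (λ x → x * (2 * r + 1) + (s + u) * (2 * r + 2)) α+m≡s+1+r ⟩
      (s + suc r) * (2 * r + 1) + (s + u) * (2 * r + 2) ∎)
    where
    open ≡-Reasoning
    m≤1+r : m ≤ suc r
    m≤1+r = +-cancelˡ-≤ s m (suc r) (≤-trans (+-monoˡ-≤ m s≤α) (≤-reflexive α+m≡s+1+r))

  measures-lattice : ∀ α β → α ≤ β + suc r → β ≤ α + suc r → α ≤ s + suc r → β ≤ s + suc r →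
                     Measures R (α * (2 * r + 1) + β * (2 * r + 2))
  measures-lattice α β α≤β+1+r β≤α+1+r α≤s+1+r β≤s+1+r with ≤-total β α | ≤-total β s | ≤-total α s
  ... | inj₁ β≤α | inj₁ β≤s | _        = measures-Q-P α β β≤α β≤s α≤β+1+r
  ... | inj₁ β≤α | inj₂ s≤β | _        = measures-B-P α β (≤-trans s≤β β≤α) s≤β α≤s+1+r β≤s+1+r
  ... | inj₂ α≤β | _        | inj₁ α≤s = measures-B-Q α β α≤β α≤s β≤α+1+r
  ... | inj₂ α≤β | _        | inj₂ s≤α = measures-B-P α β s≤α (≤-trans s≤α α≤β) α≤s+1+r β≤s+1+r

  measures-antidiagonal : ∀ α β e f →
                          α + (e + f) ≤ β + suc r → β + (e + f) ≤ α + suc r →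
                          α + (e + f) ≤ s + suc r → β + (e + f) ≤ s + suc r →
                          Measures R ((α + (e + f)) * (2 * r + 1) + β * (2 * r + 2) + e)
  measures-antidiagonal α β e f α+n≤β+1+r β+n≤α+1+r α+n≤s+1+r β+n≤s+1+r =
    subst (Measures R) lattice≡N+e (measures-lattice (α + f) (β + e)
      (≤-trans α+f≤α+n (≤-trans α+n≤β+1+r (+-monoˡ-≤ (suc r) (m≤m+n β e))))
      (≤-trans β+e≤β+n (≤-trans β+n≤α+1+r (+-monoˡ-≤ (suc r) (m≤m+n α f))))
      (≤-trans α+f≤α+n α+n≤s+1+r)
      (≤-trans β+e≤β+n β+n≤s+1+r))
    where
    α+f≤α+n : α + f ≤ α + (e + f)
    α+f≤α+n = +-monoʳ-≤ α (m≤n+m f e)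
    β+e≤β+n : β + e ≤ β + (e + f)
    β+e≤β+n = +-monoʳ-≤ β (m≤m+n e f)
    lattice≡N+e : (α + f) * (2 * r + 1) + (β + e) * (2 * r + 2)
                ≡ (α + (e + f)) * (2 * r + 1) + β * (2 * r + 2) + e
    lattice≡N+e = solve (α ∷ β ∷ e ∷ f ∷ r ∷ [])

  range-antidiagonal : ∀ α β n →
                       α + n ≤ β + suc r → β + n ≤ α + suc r → α + n ≤ s + suc r → β + n ≤ s + suc r →
                       ∀ {lo hi} → (α + n) * (2 * r + 1) + β * (2 * r + 2) ≤ lo →
                       hi ≤ (α + n) * (2 * r + 1) + β * (2 * r + 2) + suc n → MeasuresRange R lo hi
  range-antidiagonal α β n α+n≤β+1+r β+n≤α+1+r α+n≤s+1+r β+n≤s+1+r N≤lo hi≤N+1+n =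
    measuresRange λ d lo≤d d<hi → onAntidiagonal (≤-trans N≤lo lo≤d) (<-≤-trans d<hi hi≤N+1+n)
    where
    onAntidiagonal : ∀ {d} → (α + n) * (2 * r + 1) + β * (2 * r + 2) ≤ d →
                     d < (α + n) * (2 * r + 1) + β * (2 * r + 2) + suc n → Measures R d
    onAntidiagonal N≤d d<N+1+n with m≤n⇒∃[o]m+o≡n N≤d
    ... | e , refl with m≤n⇒∃[o]m+o≡n (m<1+n⇒m≤n (+-cancelˡ-< _ e (suc n) d<N+1+n))
    ... | f , refl = measures-antidiagonal α β e f α+n≤β+1+r β+n≤α+1+r α+n≤s+1+r β+n≤s+1+r

  range-sweepP : MeasuresRange R (suc r) (suc r * (2 * r + 2) + suc r)
  range-sweepP = range-iterate (λ k → k * (2 * r + 2) + suc r) (suc r) step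
    where
    step : ∀ k → k < suc r →
           MeasuresRange R (k * (2 * r + 2) + suc r) (suc k * (2 * r + 2) + suc r)
    step k k<1+r with m≤n⇒∃[o]m+o≡n (m<1+n⇒m≤n k<1+r)
    -- Matching on refl instantiates the module parameter r as k + m, visibly to the ring solver.
    ... | m , refl = range-++ belowP (range-++ antidiagonal aboveB)
      where
      belowP : MeasuresRange R (k * (2 * r + 2) + suc r) (suc (suc k * (2 * r + 1)))
      belowP = range-belowMark ∈-A (∈-P (suc k) (s≤s (m≤m+n k m)))
                 (m+o≡n⇒m≤n k (solve (k ∷ m ∷ []))) ≤-refl
      antidiagonal : MeasuresRange R (suc (suc k * (2 * r + 1))) (suc k * (2 * r + 2) + 1)
      antidiagonal = range-antidiagonal 0 1 k
                       (m+o≡n⇒m≤n (m + 2) (solve (k ∷ m ∷ [])))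
                       (s≤s (m≤m+n k m))
                       (m+o≡n⇒m≤n (s + suc m) (solve (k ∷ m ∷ s ∷ [])))
                       (m+o≡n⇒m≤n (s + m) (solve (k ∷ m ∷ s ∷ [])))
                       (≤-reflexive (solve (k ∷ m ∷ [])))
                       (≤-reflexive (solve (k ∷ m ∷ [])))
      aboveB : MeasuresRange R (suc k * (2 * r + 2) + 1) (suc k * (2 * r + 2) + suc r)
      aboveB = range-aboveMark ∈-C (∈-B m (m≤n⇒m≤1+n (m≤n+m m k)))
                 (m+o≡n⇒m≤n 1 (solve (k ∷ m ∷ s ∷ []))) (≤-reflexive (solve (k ∷ m ∷ s ∷ [])))

  range-sweepQ : MeasuresRange R (suc r * (2 * r + 2) + suc r)
                                 (s * (2 * r + 1) + (s + suc r) * (2 * r + 2) + suc r)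
  range-sweepQ = range-iterate (λ t → t * (2 * r + 1) + (t + suc r) * (2 * r + 2) + suc r) s step
    where
    step : ∀ t → t < s →
           MeasuresRange R (t * (2 * r + 1) + (t + suc r) * (2 * r + 2) + suc r)
                           (suc t * (2 * r + 1) + (suc t + suc r) * (2 * r + 2) + suc r)
    step t t<s with m≤n⇒∃[o]m+o≡n t<s
    ... | p , refl = range-++ antidiagonal₁ (range-++ belowQ (range-++ antidiagonal₂ aboveQ))
      where
      antidiagonal₁ : MeasuresRange R (t * (2 * r + 1) + (t + suc r) * (2 * r + 2) + suc r)
                                      ((suc t + r) * (2 * r + 1) + suc t * (2 * r + 2) + suc r)
      antidiagonal₁ = range-antidiagonal (suc t) (suc t) r
                        (+-monoʳ-≤ (suc t) (n≤1+n r))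
                        (+-monoʳ-≤ (suc t) (n≤1+n r))
                        (m+o≡n⇒m≤n (p + 1) (solve (t ∷ p ∷ r ∷ [])))
                        (m+o≡n⇒m≤n (p + 1) (solve (t ∷ p ∷ r ∷ [])))
                        (≤-reflexive (solve (t ∷ r ∷ [])))
                        ≤-refl
      belowQ : MeasuresRange R ((suc t + r) * (2 * r + 1) + suc t * (2 * r + 2) + suc r)
                               (suc ((suc t + suc r) * (2 * r + 1) + suc t * (2 * r + 2)))
      belowQ = range-belowMark ∈-A (∈-Q (suc t) (m≤m+n (suc t) p))
                 (≤-reflexive (solve (t ∷ r ∷ []))) ≤-refl
      antidiagonal₂ : MeasuresRange R (suc ((suc t + suc r) * (2 * r + 1) + suc t * (2 * r + 2)))
                                      ((suc t + r) * (2 * r + 1) + suc (suc t) * (2 * r + 2) + suc r)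
      antidiagonal₂ = range-antidiagonal (suc t) (suc (suc t)) r
                        (m+o≡n⇒m≤n 2 (solve (t ∷ r ∷ [])))
                        (≤-reflexive (solve (t ∷ r ∷ [])))
                        (m+o≡n⇒m≤n (p + 1) (solve (t ∷ p ∷ r ∷ [])))
                        (m+o≡n⇒m≤n p (solve (t ∷ p ∷ r ∷ [])))
                        (≤-reflexive (solve (t ∷ r ∷ [])))
                        ≤-refl
      aboveQ : MeasuresRange R ((suc t + r) * (2 * r + 1) + suc (suc t) * (2 * r + 2) + suc r)
                               (suc t * (2 * r + 1) + (suc t + suc r) * (2 * r + 2) + suc r)
      aboveQ = range-aboveMark ∈-C (∈-Q p (m≤n+m p (suc t)))
                 (m+o≡n⇒m≤n 1 (solve (t ∷ p ∷ r ∷ []))) (≤-reflexive (solve (t ∷ p ∷ r ∷ [])))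

  range-sweepB : MeasuresRange R (s * (2 * r + 1) + (s + suc r) * (2 * r + 2) + suc r)
                                 ((suc r + s) * (2 * r + 1) + (s + suc r) * (2 * r + 2) + suc r)
  range-sweepB =
    range-iterate (λ u → (u + s) * (2 * r + 1) + (s + suc r) * (2 * r + 2) + suc r) (suc r) step
    where
    step : ∀ u → u < suc r →
           MeasuresRange R ((u + s) * (2 * r + 1) + (s + suc r) * (2 * r + 2) + suc r)
                           ((suc u + s) * (2 * r + 1) + (s + suc r) * (2 * r + 2) + suc r)
    step u u<1+r with m≤n⇒∃[o]m+o≡n (m<1+n⇒m≤n u<1+r)
    ... | m , refl = range-++ belowB (range-++ antidiagonal aboveP)
      where
      m≤1+r : m ≤ suc r
      m≤1+r = m≤n⇒m≤1+n (m≤n+m m u)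
      belowB : MeasuresRange R ((u + s) * (2 * r + 1) + (s + suc r) * (2 * r + 2) + suc r)
                               ((s + suc r) * (2 * r + 1) + (s + suc u) * (2 * r + 2))
      belowB = range-belowMark ∈-A (∈-B (suc u) (s≤s (m≤m+n u m)))
                 (m+o≡n⇒m≤n m (solve (u ∷ m ∷ s ∷ []))) (n≤1+n _)
      antidiagonal : MeasuresRange R ((s + suc r) * (2 * r + 1) + (s + suc u) * (2 * r + 2))
                                     ((s + suc r) * (2 * r + 1) + (s + suc u) * (2 * r + 2) + suc m)
      antidiagonal = range-antidiagonal (s + suc u) (s + suc u) m
                       (+-monoʳ-≤ (s + suc u) m≤1+r)
                       (+-monoʳ-≤ (s + suc u) m≤1+r)
                       (≤-reflexive (solve (u ∷ m ∷ s ∷ [])))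
                       (≤-reflexive (solve (u ∷ m ∷ s ∷ [])))
                       (≤-reflexive (solve (u ∷ m ∷ s ∷ [])))
                       (≤-reflexive (solve (u ∷ m ∷ s ∷ [])))
      aboveP : MeasuresRange R ((s + suc r) * (2 * r + 1) + (s + suc u) * (2 * r + 2) + suc m)
                               ((suc u + s) * (2 * r + 1) + (s + suc r) * (2 * r + 2) + suc r)
      aboveP = range-aboveMark ∈-C (∈-P m m≤1+r)
                 (m+o≡n⇒m≤n 1 (solve (u ∷ m ∷ s ∷ []))) (≤-reflexive (solve (u ∷ m ∷ s ∷ [])))

  range-sweepE : MeasuresRange R ((suc r + s) * (2 * r + 1) + (s + suc r) * (2 * r + 2) + suc r)
                                 (i * (r + 1) + ((suc r + s) * (2 * r + 1) + (s + suc r) * (2 * r + 2) + suc r))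
  range-sweepE =
    range-iterate (λ w → w * (r + 1) + ((suc r + s) * (2 * r + 1) + (s + suc r) * (2 * r + 2) + suc r)) i
      λ w w<i → range-belowMark ∈-A (∈-E (suc w) w<i)
                  (≤-reflexive (solve (w ∷ r ∷ s ∷ []))) (≤-reflexive (solve (w ∷ r ∷ s ∷ [])))

  range-last : j ≤ r + 1 →
               MeasuresRange R (i * (r + 1) + ((suc r + s) * (2 * r + 1) + (s + suc r) * (2 * r + 2) + suc r))
                               (suc (w1length r s i j))
  range-last j≤r+1 = range-belowMark ∈-A (∈-marksFrom-last 0 (w1diffs r s i j)) L≤lo+r ≤-refl
    where
    open ≤-Reasoning
    L≤lo+r : w1length r s i j
           ≤ i * (r + 1) + ((suc r + s) * (2 * r + 1) + (s + suc r) * (2 * r + 2) + suc r) + r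
    L≤lo+r = begin
      w1length r s i j                                      ≡⟨ w1-length ⟩
      (s + suc r) * (4 * r + 3) + r + i * (r + 1) + j       ≤⟨ +-monoʳ-≤ _ j≤r+1 ⟩
      (s + suc r) * (4 * r + 3) + r + i * (r + 1) + (r + 1) ≡⟨ solve (r ∷ s ∷ i ∷ []) ⟩
      i * (r + 1) + ((suc r + s) * (2 * r + 1) + (s + suc r) * (2 * r + 2) + suc r) + r ∎

  w1-measures : j ≤ r + 1 → MeasuresRange R 0 (suc (w1length r s i j))
  w1-measures j≤r+1 =
    range-++ (range-belowMark ∈-A (∈-A ≤-refl) ≤-refl ≤-refl)
    (range-++ range-sweepP
    (range-++ range-sweepQ
    (range-++ range-sweepB
    (range-++ range-sweepE
              (range-last j≤r+1)))))

theorem5 : ∀ (r s i j : ℕ) → j ≤ r + 1 →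
    IsCompleteSparseRuler (w1length r s i j) (w1 r s i j)
theorem5 r s i j j≤r+1 =
  ruler-isSparseRuler (w1diffs r s i j) , λ d d≤L → measures (w1-measures j≤r+1) d z≤n (s≤s d≤L)
  where open Wichmann r s i j
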